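{- Let $p\ge1$ be an integer and, for $i\in\{0,\dots,p\}$, let $S_i$ be a $\Delta_i$-star with $\Delta_i\ge3$. Let $G_0=S_0$ and, for $i\in\{1,\dots,p\}$, $G_i=G_{i-1}\rhd_{v_{i-1}}S_i$ where $v_{i-1}$ is a vertex of $G_{i-1}$. Let $G=G_p$ have order $n$ and maximum degree $\Delta$, and let $\Delta_{\max}=\max\{\Delta_i:0\le i\le p\}$. Then \[ \gamma^{\rm ID}(G)\le\left(\frac{\Delta_{\max}-1}{\Delta_{\max}}\right)n+\frac{1}{\Delta_0}\le\left(\frac{\Delta-1}{\Delta}\right)n+\frac13. \]
   Context: A $\Delta$-star is $K_{1,\Delta}$. $G'\rhd_v S$ denotes the graph obtained from the disjoint union of $G'$ and a star $S$ by identifying the vertex $v$ of $G'$ with a leaf of $S$. An identifying code of $G$ is a set $C\subseteq V(G)$ such that every vertex $v$ satisfies $N[v]\cap C\neq\emptyset$ and distinct vertices $u,v$ satisfy $N[u]\cap C\neq N[v]\cap C$, where $N[v]$ is the closed neighborhood; $\gamma^{\rm ID}(G)$ is its minimum size. -}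

module Defs where

open import Data.Nat using (ℕ; zero; suc; _+_; _*_; _∸_; _≤_; _⊔_; _≡ᵇ_; _<ᵇ_)
open import Data.Bool using (Bool; true; false; _∧_; _∨_)
open import Data.Fin using (Fin; toℕ)
open import Data.Fin.Subset using (Subset; _∩_; Nonempty; ∣_∣)
open import Data.Vec using (tabulate)
open import Data.List using (List; foldr; map; allFin)
open import Relation.Binary.PropositionalEquality using (_≡_; _≢_)

-- Vertices of a graph of order n are Fin n (identified with 0..n-1 via toℕ).
--   star Δ : the Δ-star K_{1,Δ}; centre 0, leaves 1..Δ (order Δ+1).
--   glue G v Δ : G ▷_v S with S a Δ-star: new centre n, new leaves n+1..n+Δ-1,
--                and the remaining leaf of S identified with v (order n+Δ).
data StarChain : ℕ → Set where
  star : (Δ : ℕ) → 3 ≤ Δ → StarChain (suc Δ)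
  glue : ∀ {n} → StarChain n → Fin n → (Δ : ℕ) → 3 ≤ Δ → StarChain (n + Δ)

edgeᵇ : ∀ {n} → StarChain n → ℕ → ℕ → Bool
edgeᵇ (star Δ _) u v = (u ≡ᵇ 0) ∧ (0 <ᵇ v) ∧ (v <ᵇ suc Δ)
edgeᵇ {.(n + Δ)} (glue {n} G w Δ _) u v =
  edgeᵇ G u v
  ∨ ((u ≡ᵇ n) ∧ (v ≡ᵇ toℕ w))
  ∨ ((u ≡ᵇ n) ∧ (n <ᵇ v) ∧ (v <ᵇ n + Δ))

adj : ∀ {n} → StarChain n → Fin n → Fin n → Bool
adj G u v = edgeᵇ G (toℕ u) (toℕ v) ∨ edgeᵇ G (toℕ v) (toℕ u)

N : ∀ {n} → StarChain n → Fin n → Subset n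
N G v = tabulate (λ u → adj G v u)

N[_] : ∀ {n} → StarChain n → Fin n → Subset n
N[ G ] v = tabulate (λ u → (toℕ u ≡ᵇ toℕ v) ∨ adj G v u)

degree : ∀ {n} → StarChain n → Fin n → ℕ
degree G v = ∣ N G v ∣

maxDegree : ∀ {n} → StarChain n → ℕ
maxDegree {n} G = foldr _⊔_ 0 (map (degree G) (allFin n))

IsIdentifyingCode : ∀ {n} → StarChain n → Subset n → Set
IsIdentifyingCode {n} G C =
  ((v : Fin n) → Nonempty (N[ G ] v ∩ C))
  × ((u v : Fin n) → u ≢ v → (N[ G ] u ∩ C) ≢ (N[ G ] v ∩ C))
  where open import Data.Product using (_×_)

steps : ∀ {n} → StarChain n → ℕ
steps (star _ _) = 0
steps (glue G _ _ _) = suc (steps G)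

Δ₀ : ∀ {n} → StarChain n → ℕ
Δ₀ (star Δ _) = Δ
Δ₀ (glue G _ _ _) = Δ₀ G

Δmax : ∀ {n} → StarChain n → ℕ
Δmax (star Δ _) = Δ
Δmax (glue G _ Δ _) = Δmax G ⊔ Δ

{-# OPTIONS --safe #-}
-- The set C of all non-centres (leaves) is an identifying code.  Leaves are
-- pairwise non-adjacent, so a leaf x sees exactly {x} in C; a centre sees its
-- leaves, and it has at least two of them because every star has Δᵢ ≥ 3 and
-- only one leaf of each glued star is identified with an old vertex.  Two
-- centres are told apart by a leaf of the younger one, or by a leaf of the
-- older one other than the attachment vertex.  The p + 1 centres are distinct,
-- so |C| = n − p − 1, while n = 1 + Σ Δᵢ ≤ 1 + (p + 1) Δmax; the first bound
-- is arithmetic from here, and the second follows from Δmax ≤ Δ and Δ₀ ≥ 3.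
module Submission where

open import Data.Bool using (Bool; true; false; _∧_; _∨_; not; if_then_else_)
open import Data.Bool.Properties using (∨-zeroʳ; ∨-identityʳ; ∧-conicalˡ; ∧-conicalʳ; ¬-not; T-≡)
open import Data.Fin using (Fin; toℕ; fromℕ<)
open import Data.Fin.Properties using (toℕ<n; toℕ-fromℕ<; toℕ-injective)
open import Data.Fin.Subset using (Subset; ∣_∣; _∩_; _∈_; Nonempty)
open import Data.List using ([]; _∷_; foldr; map; allFin)
open import Data.List.Membership.Propositional using () renaming (_∈_ to _∈ₗ_)
open import Data.List.Membership.Propositional.Properties using (∈-allFin)
open import Data.List.Relation.Unary.Any using (here; there)
open import Data.Nat using (ℕ; zero; suc; _+_; _*_; _∸_; _≤_; _<_; _⊔_; _≡ᵇ_; _<ᵇ_; z≤n; s≤s; z<s; _≟_)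
open import Data.Nat.Properties
open import Data.Nat.Tactic.RingSolver using (solve)
open import Data.Product using (Σ; _×_; _,_)
open import Data.Sum using (_⊎_; inj₁; inj₂; [_,_]′)
open import Data.Vec using (tabulate; lookup)
open import Data.Vec.Properties using (lookup-zipWith; lookup∘tabulate; lookup⇒[]=)
open import Function using (_∘_)
open import Function.Bundles using (Equivalence)
open import Relation.Binary.PropositionalEquality using (_≡_; _≢_; refl; sym; trans; cong; cong₂; ≢-sym; module ≡-Reasoning)
open import Relation.Nullary using (¬_; yes; no; contradiction)

open import Defs

≢true⇒≡false : ∀ {b} → b ≢ true → b ≡ false
≢true⇒≡false = ¬-not

≡true⇒≢≡false : ∀ {a b} → a ≡ true → b ≡ false → a ≢ b
≡true⇒≢≡false refl refl ()

∨-true⁻ : ∀ a {b} → a ∨ b ≡ true → a ≡ true ⊎ b ≡ true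
∨-true⁻ true  _ = inj₁ refl
∨-true⁻ false e = inj₂ e

∨-trueˡ : ∀ {a} b → a ≡ true → a ∨ b ≡ true
∨-trueˡ _ refl = refl

∨-trueʳ : ∀ a {b} → b ≡ true → a ∨ b ≡ true
∨-trueʳ a refl = ∨-zeroʳ a

≡ᵇ≡true⇒≡ : ∀ m n → (m ≡ᵇ n) ≡ true → m ≡ n
≡ᵇ≡true⇒≡ m n = ≡ᵇ⇒≡ m n ∘ Equivalence.from T-≡

≡ᵇ-refl : ∀ n → (n ≡ᵇ n) ≡ true
≡ᵇ-refl n = Equivalence.to T-≡ (≡⇒≡ᵇ n n refl)

≢⇒≡ᵇ≡false : ∀ {m n} → m ≢ n → (m ≡ᵇ n) ≡ false
≢⇒≡ᵇ≡false {m} {n} m≢n = ≢true⇒≡false (m≢n ∘ ≡ᵇ≡true⇒≡ m n)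

m+n≡ᵇm : ∀ m n → (m + n ≡ᵇ m) ≡ (n ≡ᵇ 0)
m+n≡ᵇm zero    n = refl
m+n≡ᵇm (suc m) n = m+n≡ᵇm m n

<ᵇ≡true⇒< : ∀ m n → (m <ᵇ n) ≡ true → m < n
<ᵇ≡true⇒< m n = <ᵇ⇒< m n ∘ Equivalence.from T-≡

<⇒<ᵇ≡true : ∀ {m n} → m < n → (m <ᵇ n) ≡ true
<⇒<ᵇ≡true = Equivalence.to T-≡ ∘ <⇒<ᵇ

≮⇒<ᵇ≡false : ∀ {m n} → ¬ m < n → (m <ᵇ n) ≡ false
≮⇒<ᵇ≡false {m} {n} m≮n = ≢true⇒≡false (m≮n ∘ <ᵇ≡true⇒< m n)

count : (ℕ → Bool) → ℕ → ℕ
count f zero    = 0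
count f (suc k) = if f 0 then suc (count (f ∘ suc) k) else count (f ∘ suc) k

∣tabulate∣≡count : ∀ f k → ∣ tabulate {n = k} (f ∘ toℕ) ∣ ≡ count f k
∣tabulate∣≡count f zero = refl
∣tabulate∣≡count f (suc k) with f 0 | ∣tabulate∣≡count (f ∘ suc) k
... | true  | ih = cong suc ih
... | false | ih = ih

count-++ : ∀ f a b → count f (a + b) ≡ count f a + count (λ i → f (a + i)) b
count-++ f zero    b = refl
count-++ f (suc a) b with f 0
... | true  = cong suc (count-++ (f ∘ suc) a b)
... | false = count-++ (f ∘ suc) a b

count-cong : ∀ {f g} k → (∀ i → i < k → f i ≡ g i) → count f k ≡ count g k
count-cong zero    _   = refl
count-cong {f} {g} (suc k) f≗g
  with f 0 | g 0 | f≗g 0 z<s | count-cong {f ∘ suc} {g ∘ suc} k (λ i i<k → f≗g (suc i) (s≤s i<k))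
... | true  | true  | _ | ih = cong suc ih
... | false | false | _ | ih = ih

count-all : ∀ {f} k → (∀ i → i < k → f i ≡ true) → count f k ≡ k
count-all zero    _ = refl
count-all {f} (suc k) f≡true rewrite f≡true 0 z<s =
  cong suc (count-all {f ∘ suc} k (λ i i<k → f≡true (suc i) (s≤s i<k)))

count-mono : ∀ {f g} k → (∀ i → i < k → f i ≡ true → g i ≡ true) → count f k ≤ count g k
count-mono zero    _   = z≤n
count-mono {f} {g} (suc k) f⇒g
  with f 0 | g 0 | f⇒g 0 z<s | count-mono {f ∘ suc} {g ∘ suc} k (λ i i<k → f⇒g (suc i) (s≤s i<k))
... | true  | true  | _    | ih = s≤s ih
... | true  | false | f⇒g₀ | _  = contradiction (f⇒g₀ refl) λ ()
... | false | true  | _    | ih = m≤n⇒m≤1+n ih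
... | false | false | _    | ih = ih

count-tail≤ : ∀ f k → count (f ∘ suc) k ≤ count f (suc k)
count-tail≤ f k with f 0
... | true  = n≤1+n _
... | false = ≤-refl

count-pos : ∀ {f} k {w} → w < k → f w ≡ true → 0 < count f k
count-pos {f} (suc k) {zero}  _          fw rewrite fw = z<s
count-pos {f} (suc k) {suc w} (s≤s w<k) fw = <-≤-trans (count-pos {f ∘ suc} k w<k fw) (count-tail≤ f k)

count-prefix≤ : ∀ f a b → count f a ≤ count f (a + b)
count-prefix≤ f a b = ≤-trans (m≤m+n _ _) (≤-reflexive (sym (count-++ f a b)))

≤-foldr-⊔ : ∀ {A : Set} (f : A → ℕ) {x xs} → x ∈ₗ xs → f x ≤ foldr _⊔_ 0 (map f xs)
≤-foldr-⊔ f (here refl)               = m≤m⊔n _ _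
≤-foldr-⊔ f {xs = y ∷ _} (there x∈xs) = m≤n⇒m≤o⊔n (f y) (≤-foldr-⊔ f x∈xs)

-- Centres and leaves

isCentre : ∀ {n} → StarChain n → ℕ → Bool
isCentre (star _ _)         u = u ≡ᵇ 0
isCentre (glue {n} G _ _ _) u = isCentre G u ∨ (u ≡ᵇ n)

edge⇒isCentre : ∀ {n} (G : StarChain n) u v → edgeᵇ G u v ≡ true → isCentre G u ≡ true
edge⇒isCentre (star _ _) u v e = ∧-conicalˡ _ _ e
edge⇒isCentre (glue {n} G w Δ _) u v e with ∨-true⁻ (edgeᵇ G u v) e
... | inj₁ e₁ = ∨-trueˡ _ (edge⇒isCentre G u v e₁)
... | inj₂ e₂ = ∨-trueʳ (isCentre G u) ([ ∧-conicalˡ (u ≡ᵇ n) _ , ∧-conicalˡ (u ≡ᵇ n) _ ]′ (∨-true⁻ _ e₂))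

edge⇒< : ∀ {n} (G : StarChain n) u v → edgeᵇ G u v ≡ true → v < n
edge⇒< (star Δ _) u v e = <ᵇ≡true⇒< v (suc Δ) (∧-conicalʳ (0 <ᵇ v) _ (∧-conicalʳ (u ≡ᵇ 0) _ e))
edge⇒< (glue {n} G w Δ _) u v e with ∨-true⁻ (edgeᵇ G u v) e
... | inj₁ e₁ = ≤-trans (edge⇒< G u v e₁) (m≤m+n n Δ)
... | inj₂ e₂ with ∨-true⁻ ((u ≡ᵇ n) ∧ (v ≡ᵇ toℕ w)) e₂
...   | inj₁ e₃ rewrite ≡ᵇ≡true⇒≡ v (toℕ w) (∧-conicalʳ (u ≡ᵇ n) _ e₃) = ≤-trans (toℕ<n w) (m≤m+n n Δ)
...   | inj₂ e₃ = <ᵇ≡true⇒< v (n + Δ) (∧-conicalʳ (n <ᵇ v) _ (∧-conicalʳ (u ≡ᵇ n) _ e₃))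

isCentre⇒< : ∀ {n} (G : StarChain n) u → isCentre G u ≡ true → u < n
isCentre⇒< (star Δ _) u e rewrite ≡ᵇ≡true⇒≡ u 0 e = z<s
isCentre⇒< (glue {n} G w Δ (s≤s _)) u e with ∨-true⁻ (isCentre G u) e
... | inj₁ e₁ = ≤-trans (isCentre⇒< G u e₁) (m≤m+n n Δ)
... | inj₂ e₂ rewrite ≡ᵇ≡true⇒≡ u n e₂ = m<m+n n z<s

isCentre-beyond : ∀ {n} (G : StarChain n) {u} → n ≤ u → isCentre G u ≡ false
isCentre-beyond G {u} n≤u = ≢true⇒≡false (λ e → <⇒≱ (isCentre⇒< G u e) n≤u)

edge-beyond : ∀ {n} (G : StarChain n) u {v} → n ≤ v → edgeᵇ G u v ≡ false
edge-beyond G u {v} n≤v = ≢true⇒≡false (λ e → <⇒≱ (edge⇒< G u v e) n≤v)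

edge-from-nonCentre : ∀ {n} (G : StarChain n) {u} v → isCentre G u ≡ false → edgeᵇ G u v ≡ false
edge-from-nonCentre G {u} v nc = ≢true⇒≡false (λ e → ≡true⇒≢≡false (edge⇒isCentre G u v e) nc refl)

nonCentre≢centre : ∀ {n} (G : StarChain n) {x y} → isCentre G x ≡ false → isCentre G y ≡ true → x ≢ y
nonCentre≢centre G nc c x≡y = ≡true⇒≢≡false c nc (cong (isCentre G) (sym x≡y))

record Leaf {n} (G : StarChain n) (c : ℕ) : Set where
  constructor leaf
  field
    vertex    : ℕ
    vertex<n  : vertex < n
    nonCentre : isCentre G vertex ≡ false
    edge      : edgeᵇ G c vertex ≡ true
open Leaf

module Glue {n} (G : StarChain n) (w : Fin n) (Δ : ℕ) (3≤Δ : 3 ≤ Δ) where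

  G′ : StarChain (n + Δ)
  G′ = glue G w Δ 3≤Δ

  isCentre-old : ∀ {u} → u < n → isCentre G′ u ≡ isCentre G u
  isCentre-old {u} u<n = trans (cong (isCentre G u ∨_) (≢⇒≡ᵇ≡false (<⇒≢ u<n))) (∨-identityʳ _)

  isCentre-new : ∀ i → isCentre G′ (n + i) ≡ (i ≡ᵇ 0)
  isCentre-new i = cong₂ _∨_ (isCentre-beyond G (m≤m+n n i)) (m+n≡ᵇm n i)

  edge-old : ∀ {u v} → u < n → edgeᵇ G′ u v ≡ edgeᵇ G u v
  edge-old {u} {v} u<n rewrite ≢⇒≡ᵇ≡false (<⇒≢ u<n) = ∨-identityʳ _

  edge-attach : edgeᵇ G′ n (toℕ w) ≡ true
  edge-attach = ∨-trueʳ (edgeᵇ G n (toℕ w)) (∨-trueˡ _ (cong₂ _∧_ (≡ᵇ-refl n) (≡ᵇ-refl (toℕ w))))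

  edge-new : ∀ {i} → 0 < i → i < Δ → edgeᵇ G′ n (n + i) ≡ true
  edge-new 0<i i<Δ = ∨-trueʳ (edgeᵇ G n _) (∨-trueʳ _
    (cong₂ _∧_ (≡ᵇ-refl n) (cong₂ _∧_ (<⇒<ᵇ≡true (m<m+n n 0<i)) (<⇒<ᵇ≡true (+-monoʳ-< n i<Δ)))))

  edge-new-old : ∀ {x} → x < n → x ≢ toℕ w → edgeᵇ G′ n x ≡ false
  edge-new-old {x} x<n x≢w
    rewrite edge-from-nonCentre G x (isCentre-beyond G (≤-refl {n}))
          | ≡ᵇ-refl n | ≢⇒≡ᵇ≡false x≢w | ≮⇒<ᵇ≡false (<⇒≯ x<n) = refl

  lift-leaf : ∀ {c} → Leaf G c → Leaf G′ c
  lift-leaf (leaf x x<n nc e) = leaf x (≤-trans x<n (m≤m+n n Δ)) (trans (isCentre-old x<n) nc) (∨-trueˡ _ e)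

  new-leaf : ∀ j → suc j < Δ → Leaf G′ n
  new-leaf j j<Δ = leaf (n + suc j) (+-monoʳ-< n j<Δ) (isCentre-new (suc j)) (edge-new z<s j<Δ)

two-leaves : ∀ {n} (G : StarChain n) {c} → isCentre G c ≡ true →
  Σ (Leaf G c) λ ℓ → Σ (Leaf G c) λ ℓ′ → vertex ℓ ≢ vertex ℓ′
two-leaves (star _ (s≤s (s≤s (s≤s _)))) {c} e with refl ← ≡ᵇ≡true⇒≡ c 0 e =
  leaf 1 (s≤s (s≤s z≤n)) refl refl , leaf 2 (s≤s (s≤s (s≤s z≤n))) refl refl , λ ()
two-leaves (glue {n} G w Δ p@(s≤s (s≤s (s≤s _)))) {c} e with ∨-true⁻ (isCentre G c) e
... | inj₁ e₁ = let ℓ , ℓ′ , ℓ≢ℓ′ = two-leaves G e₁ in lift-leaf ℓ , lift-leaf ℓ′ , ℓ≢ℓ′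
  where open Glue G w Δ p
... | inj₂ e₂ with refl ← ≡ᵇ≡true⇒≡ c n e₂ =
  new-leaf 0 (s≤s (s≤s z≤n)) , new-leaf 1 (s≤s (s≤s (s≤s z≤n))) ,
  λ eq → contradiction (+-cancelˡ-≡ n 1 2 eq) λ ()
  where open Glue G w Δ p

leaf-avoiding : ∀ {n} (G : StarChain n) {c} → isCentre G c ≡ true → ∀ x →
  Σ (Leaf G c) λ ℓ → vertex ℓ ≢ x
leaf-avoiding G e x with two-leaves G e
... | ℓ , ℓ′ , ℓ≢ℓ′ with vertex ℓ ≟ x
...   | yes refl = ℓ′ , ≢-sym ℓ≢ℓ′
...   | no ℓ≢x   = ℓ , ℓ≢x

private-leaf : ∀ {n} (G : StarChain n) {c c′} → isCentre G c ≡ true → isCentre G c′ ≡ true → c ≢ c′ →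
  Σ (Leaf G c) λ ℓ → edgeᵇ G c′ (vertex ℓ) ≡ false
private-leaf (star _ _) {c} {c′} e e′ c≢c′ =
  contradiction (trans (≡ᵇ≡true⇒≡ c 0 e) (sym (≡ᵇ≡true⇒≡ c′ 0 e′))) c≢c′
private-leaf (glue {n} G w Δ p@(s≤s (s≤s _))) {c} {c′} e e′ c≢c′
  with ∨-true⁻ (isCentre G c) e | ∨-true⁻ (isCentre G c′) e′
... | inj₁ e₁ | inj₁ e₁′ = let ℓ , ∉ = private-leaf G e₁ e₁′ c≢c′ in
  lift-leaf ℓ , trans (edge-old (isCentre⇒< G c′ e₁′)) ∉
  where open Glue G w Δ p
... | inj₂ e₂ | inj₁ e₁′ with refl ← ≡ᵇ≡true⇒≡ c n e₂ =
  new-leaf 0 (s≤s (s≤s z≤n)) , trans (edge-old (isCentre⇒< G c′ e₁′)) (edge-beyond G c′ (m≤m+n n 1))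
  where open Glue G w Δ p
... | inj₁ e₁ | inj₂ e₂′ with refl ← ≡ᵇ≡true⇒≡ c′ n e₂′ = let ℓ , ℓ≢w = leaf-avoiding G e₁ (toℕ w) in
  lift-leaf ℓ , edge-new-old (vertex<n ℓ) ℓ≢w
  where open Glue G w Δ p
... | inj₂ e₂ | inj₂ e₂′ = contradiction (trans (≡ᵇ≡true⇒≡ c n e₂) (sym (≡ᵇ≡true⇒≡ c′ n e₂′))) c≢c′

-- The identifying code

nonCentres : ∀ {n} → StarChain n → Subset n
nonCentres G = tabulate (not ∘ isCentre G ∘ toℕ)

codeTrace : ∀ {n} → StarChain n → ℕ → ℕ → Bool
codeTrace G v x = ((x ≡ᵇ v) ∨ (edgeᵇ G v x ∨ edgeᵇ G x v)) ∧ not (isCentre G x)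

lookup-codeTrace : ∀ {n} (G : StarChain n) (v : Fin n) {x} (x<n : x < n) →
  lookup (N[ G ] v ∩ nonCentres G) (fromℕ< x<n) ≡ codeTrace G (toℕ v) x
lookup-codeTrace G v x<n = begin
  lookup (N[ G ] v ∩ nonCentres G) y
    ≡⟨ lookup-zipWith _∧_ y (N[ G ] v) (nonCentres G) ⟩
  lookup (N[ G ] v) y ∧ lookup (nonCentres G) y
    ≡⟨ cong₂ _∧_ (lookup∘tabulate _ y) (lookup∘tabulate _ y) ⟩
  codeTrace G (toℕ v) (toℕ y)
    ≡⟨ cong (codeTrace G (toℕ v)) (toℕ-fromℕ< x<n) ⟩
  codeTrace G (toℕ v) _ ∎
  where
  open ≡-Reasoning
  y = fromℕ< x<n

codeTrace-self : ∀ {n} (G : StarChain n) {x} → isCentre G x ≡ false → codeTrace G x x ≡ true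
codeTrace-self G {x} nc = cong₂ _∧_ (∨-trueˡ _ (≡ᵇ-refl x)) (cong not nc)

codeTrace-leaf : ∀ {n} (G : StarChain n) {v} (ℓ : Leaf G v) → codeTrace G v (vertex ℓ) ≡ true
codeTrace-leaf G {v} ℓ = cong₂ _∧_ (∨-trueʳ (vertex ℓ ≡ᵇ v) (∨-trueˡ _ (edge ℓ))) (cong not (nonCentre ℓ))

codeTrace-absent : ∀ {n} (G : StarChain n) {v x} → isCentre G x ≡ false → x ≢ v → edgeᵇ G v x ≡ false →
  codeTrace G v x ≡ false
codeTrace-absent G {v} {x} nc x≢v ∉ rewrite ≢⇒≡ᵇ≡false x≢v | ∉ | edge-from-nonCentre G v nc = refl

codeTrace-separates : ∀ {n} (G : StarChain n) {a b} → a < n → a ≢ b →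
  Σ ℕ λ x → x < n × codeTrace G a x ≢ codeTrace G b x
codeTrace-separates G {a} {b} a<n a≢b with isCentre G a in ea | isCentre G b in eb
... | false | false =
  a , a<n , ≡true⇒≢≡false (codeTrace-self G ea) (codeTrace-absent G ea a≢b (edge-from-nonCentre G a eb))
... | false | true = let ℓ , ℓ≢a = leaf-avoiding G eb a in
  vertex ℓ , vertex<n ℓ ,
  ≢-sym (≡true⇒≢≡false (codeTrace-leaf G ℓ) (codeTrace-absent G (nonCentre ℓ) ℓ≢a (edge-from-nonCentre G _ ea)))
... | true | false = let ℓ , ℓ≢b = leaf-avoiding G ea b in
  vertex ℓ , vertex<n ℓ ,
  ≡true⇒≢≡false (codeTrace-leaf G ℓ) (codeTrace-absent G (nonCentre ℓ) ℓ≢b (edge-from-nonCentre G _ eb))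
... | true | true = let ℓ , ∉ = private-leaf G ea eb a≢b in
  vertex ℓ , vertex<n ℓ ,
  ≡true⇒≢≡false (codeTrace-leaf G ℓ) (codeTrace-absent G (nonCentre ℓ) (nonCentre≢centre G (nonCentre ℓ) eb) ∉)

nonCentres-identifying : ∀ {n} (G : StarChain n) → IsIdentifyingCode G (nonCentres G)
nonCentres-identifying {n} G = dominating , separating
  where
  traced : (v : Fin n) {x : ℕ} (x<n : x < n) → codeTrace G (toℕ v) x ≡ true →
    fromℕ< x<n ∈ N[ G ] v ∩ nonCentres G
  traced v x<n t = lookup⇒[]= _ _ (trans (lookup-codeTrace G v x<n) t)

  dominating : ∀ v → Nonempty (N[ G ] v ∩ nonCentres G)
  dominating v with isCentre G (toℕ v) in e
  ... | false = _ , traced v (toℕ<n v) (codeTrace-self G e)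
  ... | true  = let ℓ , _ = two-leaves G e in _ , traced v (vertex<n ℓ) (codeTrace-leaf G ℓ)

  separating : ∀ u v → u ≢ v → N[ G ] u ∩ nonCentres G ≢ N[ G ] v ∩ nonCentres G
  separating u v u≢v eq = let x , x<n , differ = codeTrace-separates G (toℕ<n u) (u≢v ∘ toℕ-injective) in
    differ (trans (sym (lookup-codeTrace G u x<n))
                  (trans (cong (λ s → lookup s (fromℕ< x<n)) eq) (lookup-codeTrace G v x<n)))

-- Order and degrees

nonCentre-count : ∀ {n} (G : StarChain n) → suc (steps G) + count (not ∘ isCentre G) n ≡ n
nonCentre-count (star Δ _) = cong suc (count-all {λ _ → true} Δ (λ _ _ → refl))
nonCentre-count (glue {n} G w (suc Δ′) p) = begin
  suc (suc s) + count f′ (n + suc Δ′)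
    ≡⟨ cong (suc (suc s) +_) (count-++ f′ n (suc Δ′)) ⟩
  suc (suc s) + (count f′ n + count (λ i → f′ (n + i)) (suc Δ′))
    ≡⟨ cong₂ (λ a b → suc (suc s) + (a + b)) old-vertices new-vertices ⟩
  suc (suc s + (count f n + Δ′))
    ≡⟨ cong suc (sym (+-assoc (suc s) (count f n) Δ′)) ⟩
  suc (suc s + count f n + Δ′)
    ≡⟨ cong (λ m → suc (m + Δ′)) (nonCentre-count G) ⟩
  suc (n + Δ′)
    ≡⟨ sym (+-suc n Δ′) ⟩
  n + suc Δ′ ∎
  where
  open ≡-Reasoning
  open Glue G w (suc Δ′) p
  s : ℕ
  s = steps G
  f f′ : ℕ → Bool
  f  = not ∘ isCentre G
  f′ = not ∘ isCentre G′
  old-vertices : count f′ n ≡ count f n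
  old-vertices = count-cong n (λ i i<n → cong not (isCentre-old i<n))
  new-vertices : count (λ i → f′ (n + i)) (suc Δ′) ≡ Δ′
  new-vertices = trans (count-cong (suc Δ′) (λ i _ → cong not (isCentre-new i)))
                       (count-all {λ _ → true} Δ′ (λ _ _ → refl))

∣nonCentres∣ : ∀ {n} (G : StarChain n) → suc (steps G) + ∣ nonCentres G ∣ ≡ n
∣nonCentres∣ {n} G = trans (cong (suc (steps G) +_) (∣tabulate∣≡count (not ∘ isCentre G) n)) (nonCentre-count G)

order≤ : ∀ {n} (G : StarChain n) → n ≤ suc (suc (steps G) * Δmax G)
order≤ (star Δ _) = s≤s (m≤m+n Δ 0)
order≤ (glue {n} G w Δ _) = begin
  n + Δ
    ≤⟨ +-mono-≤ (≤-trans (order≤ G) (s≤s (*-monoʳ-≤ (suc s) (m≤m⊔n M Δ)))) (m≤n⊔m M Δ) ⟩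
  suc (suc s * (M ⊔ Δ)) + (M ⊔ Δ)
    ≡⟨ cong suc (+-comm (suc s * (M ⊔ Δ)) (M ⊔ Δ)) ⟩
  suc (suc (suc s) * (M ⊔ Δ)) ∎
  where
  open ≤-Reasoning
  s = steps G
  M = Δmax G

outDegree : ∀ {n} → StarChain n → ℕ → ℕ
outDegree {n} G c = count (edgeᵇ G c) n

outDegree-glue-old : ∀ {n} (G : StarChain n) w Δ p c → outDegree G c ≤ outDegree (glue G w Δ p) c
outDegree-glue-old {n} G w Δ p c =
  ≤-trans (count-mono n (λ v _ e → ∨-trueˡ _ e)) (count-prefix≤ (edgeᵇ (glue G w Δ p) c) n Δ)

outDegree-glue-new : ∀ {n} (G : StarChain n) w Δ′ p → suc Δ′ ≤ outDegree (glue G w (suc Δ′) p) n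
outDegree-glue-new {n} G w Δ′ p = begin
  suc Δ′
    ≤⟨ +-mono-≤ (count-pos n (toℕ<n w) edge-attach) new-leaves ⟩
  count g n + count (λ i → g (n + i)) (suc Δ′)
    ≡⟨ count-++ g n (suc Δ′) ⟨
  count g (n + suc Δ′) ∎
  where
  open ≤-Reasoning
  open Glue G w (suc Δ′) p
  g : ℕ → Bool
  g = edgeᵇ G′ n
  new-leaves : Δ′ ≤ count (λ i → g (n + i)) (suc Δ′)
  new-leaves = ≤-trans (≤-reflexive (sym (count-all Δ′ (λ i i<Δ′ → edge-new z<s (s≤s i<Δ′)))))
                       (count-tail≤ (λ i → g (n + i)) Δ′)

Δmax≤outDegree : ∀ {n} (G : StarChain n) → Σ ℕ λ c → c < n × Δmax G ≤ outDegree G c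
Δmax≤outDegree (star Δ _) = 0 , z<s , ≤-reflexive (sym (count-all Δ (λ i i<Δ → <⇒<ᵇ≡true i<Δ)))
Δmax≤outDegree (glue {n} G w (suc Δ′) p) with ≤-total (Δmax G) (suc Δ′)
... | inj₁ M≤Δ rewrite m≤n⇒m⊔n≡n M≤Δ = n , m<m+n n z<s , outDegree-glue-new G w Δ′ p
... | inj₂ Δ≤M rewrite m≥n⇒m⊔n≡m Δ≤M = let c , c<n , M≤out = Δmax≤outDegree G in
  c , ≤-trans c<n (m≤m+n n (suc Δ′)) , ≤-trans M≤out (outDegree-glue-old G w (suc Δ′) p c)

Δmax≤maxDegree : ∀ {n} (G : StarChain n) → Δmax G ≤ maxDegree G
Δmax≤maxDegree {n} G = let c , c<n , M≤out = Δmax≤outDegree G ; v = fromℕ< c<n in begin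
  Δmax G                 ≤⟨ M≤out ⟩
  outDegree G c          ≡⟨ cong (outDegree G) (toℕ-fromℕ< c<n) ⟨
  outDegree G (toℕ v)    ≤⟨ outDegree≤degree v ⟩
  degree G v             ≤⟨ ≤-foldr-⊔ (degree G) (∈-allFin v) ⟩
  maxDegree G            ∎
  where
  open ≤-Reasoning
  outDegree≤degree : ∀ v → outDegree G (toℕ v) ≤ degree G v
  outDegree≤degree v = begin
    outDegree G (toℕ v)                                           ≤⟨ count-mono n (λ x _ e → ∨-trueˡ _ e) ⟩
    count (λ x → edgeᵇ G (toℕ v) x ∨ edgeᵇ G x (toℕ v)) n         ≡⟨ ∣tabulate∣≡count _ n ⟨
    degree G v                                                    ∎

Δ₀≥3 : ∀ {n} (G : StarChain n) → 3 ≤ Δ₀ G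
Δ₀≥3 (star _ 3≤Δ)   = 3≤Δ
Δ₀≥3 (glue G _ _ _) = Δ₀≥3 G

Δ₀≤Δmax : ∀ {n} (G : StarChain n) → Δ₀ G ≤ Δmax G
Δ₀≤Δmax (star _ _)     = ≤-refl
Δ₀≤Δmax (glue G _ Δ _) = m≤n⇒m≤n⊔o Δ (Δ₀≤Δmax G)

code-size-arith : ∀ {c k n M d} → k + c ≡ n → n ≤ suc (k * M) → d ≤ M → 1 ≤ M →
  c * M * d ≤ (M ∸ 1) * n * d + M
code-size-arith {c} {k} {M = suc a} {d} refl n≤ d≤M _ = begin
  c * suc a * d                   ≡⟨ solve (a ∷ c ∷ d ∷ []) ⟩
  a * c * d + c * d               ≤⟨ +-monoʳ-≤ (a * c * d) (*-monoˡ-≤ d c≤) ⟩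
  a * c * d + (d + k * a * d)     ≤⟨ +-monoʳ-≤ (a * c * d) (+-monoˡ-≤ (k * a * d) d≤M) ⟩
  a * c * d + (suc a + k * a * d) ≡⟨ solve (a ∷ c ∷ d ∷ k ∷ []) ⟩
  a * (k + c) * d + suc a         ∎
  where
  open ≤-Reasoning
  c≤ : c ≤ suc (k * a)
  c≤ = +-cancelˡ-≤ k c (suc (k * a))
         (≤-trans n≤ (≤-reflexive (trans (cong suc (*-suc k a)) (sym (+-suc k (k * a))))))

degree-ratio-arith : ∀ {M D d} n → 1 ≤ M → M ≤ D → 3 ≤ d →
  3 * D * ((M ∸ 1) * n * d + M) ≤ 3 * M * d * ((D ∸ 1) * n) + M * d * D
degree-ratio-arith {suc a} {D} {d@(suc (suc (suc e)))} n _ M≤D (s≤s (s≤s (s≤s z≤n))) with m≤n⇒∃[o]m+o≡n M≤D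
... | k , refl = begin
  3 * (suc a + k) * (a * n * d + suc a)
    ≤⟨ m≤m+n _ _ ⟩
  3 * (suc a + k) * (a * n * d + suc a) + (3 * n * d * k + suc a * (suc a + k) * e)
    ≡⟨ solve (a ∷ k ∷ n ∷ e ∷ []) ⟩
  3 * suc a * d * ((a + k) * n) + suc a * d * (suc a + k) ∎
  where open ≤-Reasoning

-- The bound holds for a single star as well.
corollary4p4 : ∀ {n} (G : StarChain n) → 1 ≤ steps G →
    (Σ (Subset n) λ C → IsIdentifyingCode G C
        × ∣ C ∣ * Δmax G * Δ₀ G ≤ (Δmax G ∸ 1) * n * Δ₀ G + Δmax G)
    × (3 * maxDegree G * ((Δmax G ∸ 1) * n * Δ₀ G + Δmax G)
        ≤ 3 * Δmax G * Δ₀ G * ((maxDegree G ∸ 1) * n) + Δmax G * Δ₀ G * maxDegree G)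
corollary4p4 {n} G _ =
    ( nonCentres G
    , nonCentres-identifying G
    , code-size-arith {c = ∣ nonCentres G ∣} (∣nonCentres∣ G) (order≤ G) (Δ₀≤Δmax G) 1≤Δmax )
  , degree-ratio-arith n 1≤Δmax (Δmax≤maxDegree G) (Δ₀≥3 G)
  where
  1≤Δmax : 1 ≤ Δmax G
  1≤Δmax = ≤-trans (s≤s z≤n) (≤-trans (Δ₀≥3 G) (Δ₀≤Δmax G))
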